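{- Let $K$ be a finite graded poset, let $P$ be an idempotent of the monoid $M_p^K$, and let $v\in\mathrm{Im}(P)$. Then $P_v=[v,v^P]$ for some $v^P\in P_v$, and $$K=\biguplus_{v\in\mathrm{Im}(P)}[v,v^P]$$ (disjoint union).
   Context: A finite poset is graded if it has a minimum, a maximum $\hat 1$ and a rank function; $x\vartriangleleft y$ means $y$ covers $x$. $\mathrm{Or}(K)$ is the monoid under composition of order preserving regressive ($f(x)\leqslant x$) maps $K\to K$. A partial matching is $M_p:K\to K$ with $M_p\circ M_p=\mathrm{id}_K$, $M_p(\hat 1)\vartriangleleft\hat 1$, and for every $x$ either $M_p(x)\vartriangleleft x$, $x\vartriangleleft M_p(x)$ or $M_p(x)=x$; it is a special partial matching if $x\vartriangleleft y$ and $x\ne M_p(y)$ imply $M_p(x)\leqslant M_p(y)$. $P^{M_p}(x)=x$ if $x\leqslant M_p(x)$ and $P^{M_p}(x)=M_p(x)$ if $M_p(x)\vartriangleleft x$. $M_p^K$ is the submonoid of $\mathrm{Or}(K)$ generated by $\mathrm{id}_K$ and all $P^{M_p}$, $M_p$ a special partial matching. For $f:K\to K$, $f_y:=\{x:f(x)=y\}$; $[a,b]=\{z:a\leqslant z\leqslant b\}$. -}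

module Defs where

open import Data.Nat using (ℕ; zero; suc)
open import Data.Fin using (Fin)
open import Data.Product using (Σ; _×_; ∃; _,_)
open import Data.Sum using (_⊎_)
open import Data.List using (List; []; _∷_)
open import Function using (_∘_; id)
open import Relation.Nullary using (¬_; Dec; yes; no)
open import Relation.Binary.Core using (Rel)
open import Relation.Binary.Definitions using (Decidable)
open import Relation.Binary.Structures using (IsPartialOrder)
open import Relation.Binary.PropositionalEquality using (_≡_; _≢_)

record GradedPoset : Set₁ where
  field
    n         : ℕ
    _≤_       : Rel (Fin n) _
    isPO      : IsPartialOrder _≡_ _≤_
    _≤?_      : Decidable _≤_

  K : Set
  K = Fin n

  _<_ : K → K → Set
  x < y = (x ≤ y) × (x ≢ y)

  _⋖_ : K → K → Set
  x ⋖ y = (x < y) × (∀ z → ¬ ((x < z) × (z < y)))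

  field
    bot       : K
    bot-min   : ∀ x → bot ≤ x
    top       : K
    top-max   : ∀ x → x ≤ top
    rank      : K → ℕ
    rank-bot  : rank bot ≡ zero
    rank-⋖    : ∀ {x y} → x ⋖ y → rank y ≡ suc (rank x)

module _ (𝒦 : GradedPoset) where
  open GradedPoset 𝒦

  record PartialMatching (M : K → K) : Set where
    field
      invol   : ∀ x → M (M x) ≡ x
      top-cov : M top ⋖ top
      cases   : ∀ x → (M x ⋖ x) ⊎ (x ⋖ M x) ⊎ (M x ≡ x)

  record SpecialPartialMatching (M : K → K) : Set where
    field
      isPM    : PartialMatching M
      special : ∀ x y → x ⋖ y → x ≢ M y → M x ≤ M y

  PM : (K → K) → K → K
  PM M x with x ≤? M x
  ... | yes _ = x
  ... | no  _ = M x

  SPMs : Set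
  SPMs = Σ (K → K) SpecialPartialMatching

  evalWord : List SPMs → K → K
  evalWord []             = id
  evalWord ((M , _) ∷ ws) = PM M ∘ evalWord ws

  -- f ∈ M_p^K : f is (pointwise) a finite composite of generators P^{M}
  -- (the empty composite being id_K)
  InMpK : (K → K) → Set
  InMpK f = Σ (List SPMs) λ w → ∀ x → f x ≡ evalWord w x

  Idempotent : (K → K) → Set
  Idempotent f = ∀ x → f (f x) ≡ f x

  InIm : (K → K) → K → Set
  InIm f v = ∃ λ x → f x ≡ v

  InFibre : (K → K) → K → K → Set
  InFibre f y x = f x ≡ y

  InInterval : K → K → K → Set
  InInterval a b z = (a ≤ z) × (z ≤ b)

-- Every generator P^M is the lower adjoint of a Galois connection on K, whose
-- upper adjoint lifts x to M x whenever x ≤ M x; this is checked on covers,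
-- where it is exactly the defining property of a special matching. Hence every
-- element P of M_p^K is a regressive lower adjoint, with upper adjoint g say.
-- If moreover P is idempotent and v = P v, then P x = v iff v ≤ x ≤ g v: one
-- direction is regressivity plus adjunction, the other is adjunction plus
-- monotonicity. So v^P = g v, and the fibres of P partition K.
module Submission where

open import Defs
open import Data.Fin.Induction using (po-wellFounded; po-noetherian)
open import Data.Fin.Properties using (any?; _≟_)
open import Data.List using (List; []; _∷_)
open import Data.Product using (Σ; _×_; ∃; _,_; proj₁; proj₂)
open import Data.Sum using (inj₁; inj₂)
open import Data.Empty using (⊥-elim)
open import Function using (_⇔_; _∘_; id; flip)
open import Function.Bundles using (Equivalence; mk⇔)
open import Induction.WellFounded using (Acc; acc)
open import Relation.Binary.Core using (Rel)
open import Relation.Binary.Definitions using (Adjoint; Monotonic₁; Decidable)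
open import Relation.Binary.Structures using (IsPartialOrder)
open import Relation.Binary.PropositionalEquality using (_≡_; refl; sym; trans; cong; subst)
open import Relation.Nullary using (¬_; yes; no)
open import Relation.Nullary.Decidable using (_×-dec_; ¬?)

module GaloisConnection {a ℓ} {A : Set a} {_≤_ : Rel A ℓ}
                        (isPO : IsPartialOrder _≡_ _≤_) where
  open IsPartialOrder isPO using (antisym) renaming (refl to ≤-refl; trans to ≤-trans)

  adjoint-id : Adjoint _≤_ _≤_ id id
  adjoint-id = id , id

  adjoint-∘ : ∀ {f g f′ g′} → Adjoint _≤_ _≤_ f g → Adjoint _≤_ _≤_ f′ g′ →
              Adjoint _≤_ _≤_ (f′ ∘ f) (g ∘ g′)
  adjoint-∘ f⊣g f′⊣g′ = proj₁ f⊣g ∘ proj₁ f′⊣g′ , proj₂ f′⊣g′ ∘ proj₂ f⊣g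

  adjoint-resp-≗ : ∀ {f f′ g} → (∀ x → f′ x ≡ f x) →
                   Adjoint _≤_ _≤_ f g → Adjoint _≤_ _≤_ f′ g
  adjoint-resp-≗ {f} {f′} f′≗f f⊣g {x} {y} =
      proj₁ f⊣g ∘ subst (_≤ y) (f′≗f x)
    , subst (_≤ y) (sym (f′≗f x)) ∘ proj₂ f⊣g

  lowerAdjoint-monotone : ∀ {f g} → Adjoint _≤_ _≤_ f g → Monotonic₁ _≤_ _≤_ f
  lowerAdjoint-monotone f⊣g x≤y = proj₂ f⊣g (≤-trans x≤y (proj₁ f⊣g ≤-refl))

  fibre⇔interval : ∀ {f g} → Adjoint _≤_ _≤_ f g → (∀ x → f x ≤ x) →
                   ∀ {v} → f v ≡ v → ∀ x → f x ≡ v ⇔ (v ≤ x × x ≤ g v)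
  fibre⇔interval {f} {g} f⊣g f≤id {v} fv≡v x = mk⇔ to from
    where
    to : f x ≡ v → v ≤ x × x ≤ g v
    to refl = f≤id x , proj₁ f⊣g ≤-refl

    from : v ≤ x × x ≤ g v → f x ≡ v
    from (v≤x , x≤gv) = antisym (proj₂ f⊣g x≤gv)
      (subst (_≤ f x) fv≡v (lowerAdjoint-monotone f⊣g v≤x))

module _ (𝒦 : GradedPoset) where
  open GradedPoset 𝒦
  open IsPartialOrder isPO using (reflexive) renaming (refl to ≤-refl; trans to ≤-trans)
  open GaloisConnection isPO

  _<?_ : Decidable _<_
  x <? y = (x ≤? y) ×-dec ¬? (x ≟ y)

  <⇒≤⋖ : ∀ {u y} → u < y → ∃ λ w → u ≤ w × w ⋖ y
  <⇒≤⋖ {u} u<y = climb u (po-noetherian isPO u) ≤-refl u<y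
    where
    climb : ∀ {y} z → Acc (flip _<_) z → u ≤ z → z < y → ∃ λ w → u ≤ w × w ⋖ y
    climb {y} z (acc above) u≤z z<y with any? (λ w → z <? w ×-dec w <? y)
    ... | yes (w , z<w , w<y) = climb w (above z<w) (≤-trans u≤z (proj₁ z<w)) w<y
    ... | no  nothing-between = z , u≤z , z<y , λ w p → nothing-between (w , p)

  ⋖-monotone⇒monotone : ∀ {f} → (∀ {x y} → x ⋖ y → f x ≤ f y) →
                        Monotonic₁ _≤_ _≤_ f
  ⋖-monotone⇒monotone {f} mono⋖ {u} {y} = go y (po-wellFounded isPO y)
    where
    go : ∀ y → Acc _<_ y → u ≤ y → f u ≤ f y
    go y (acc below) u≤y with u ≟ y
    ... | yes refl = ≤-refl
    ... | no  u≢y with <⇒≤⋖ (u≤y , u≢y)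
    ...   | w , u≤w , w⋖y = ≤-trans (go w (below (proj₁ w⋖y)) u≤w) (mono⋖ w⋖y)

  PMᵘ : (K → K) → K → K
  PMᵘ M x with x ≤? M x
  ... | yes _ = M x
  ... | no  _ = x

  module _ {M : K → K} (sp : SpecialPartialMatching 𝒦 M) where
    open SpecialPartialMatching sp
    open PartialMatching isPM

    ≰M⇒M≤ : ∀ {x} → ¬ (x ≤ M x) → M x ≤ x
    ≰M⇒M≤ {x} x≰Mx with cases x
    ... | inj₁ Mx⋖x        = proj₁ (proj₁ Mx⋖x)
    ... | inj₂ (inj₁ x⋖Mx) = ⊥-elim (x≰Mx (proj₁ (proj₁ x⋖Mx)))
    ... | inj₂ (inj₂ Mx≡x) = reflexive Mx≡x

    PM-regressive : ∀ x → PM 𝒦 M x ≤ x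
    PM-regressive x with x ≤? M x
    ... | yes _    = ≤-refl
    ... | no  x≰Mx = ≰M⇒M≤ x≰Mx

    PM≤M : ∀ x → PM 𝒦 M x ≤ M x
    PM≤M x with x ≤? M x
    ... | yes x≤Mx = x≤Mx
    ... | no  _    = ≤-refl

    id≤PMᵘ : ∀ x → x ≤ PMᵘ M x
    id≤PMᵘ x with x ≤? M x
    ... | yes x≤Mx = x≤Mx
    ... | no  _    = ≤-refl

    M≤PMᵘ : ∀ x → M x ≤ PMᵘ M x
    M≤PMᵘ x with x ≤? M x
    ... | yes _    = ≤-refl
    ... | no  x≰Mx = ≰M⇒M≤ x≰Mx

    PM-⋖-monotone : ∀ {x y} → x ⋖ y → PM 𝒦 M x ≤ PM 𝒦 M y
    PM-⋖-monotone {x} {y} x⋖y with y ≤? M y | x ≟ M y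
    ... | yes _ | _       = ≤-trans (PM-regressive x) (proj₁ (proj₁ x⋖y))
    ... | no  _ | yes x≡My = ≤-trans (PM-regressive x) (reflexive x≡My)
    ... | no  _ | no  x≢My = ≤-trans (PM≤M x) (special x y x⋖y x≢My)

    PMᵘ-⋖-monotone : ∀ {x y} → x ⋖ y → PMᵘ M x ≤ PMᵘ M y
    PMᵘ-⋖-monotone {x} {y} x⋖y with x ≤? M x | x ≟ M y
    ... | no  _ | _        = ≤-trans (proj₁ (proj₁ x⋖y)) (id≤PMᵘ y)
    ... | yes _ | yes x≡My = ≤-trans (reflexive (trans (cong M x≡My) (invol y))) (id≤PMᵘ y)
    ... | yes _ | no  x≢My = ≤-trans (special x y x⋖y x≢My) (M≤PMᵘ y)

    id≤PMᵘ∘PM : ∀ x → x ≤ PMᵘ M (PM 𝒦 M x)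
    id≤PMᵘ∘PM x with x ≤? M x
    ... | yes _ = id≤PMᵘ x
    ... | no  _ = ≤-trans (reflexive (sym (invol x))) (M≤PMᵘ (M x))

    PM∘PMᵘ≤id : ∀ y → PM 𝒦 M (PMᵘ M y) ≤ y
    PM∘PMᵘ≤id y with y ≤? M y
    ... | yes _ = ≤-trans (PM≤M (M y)) (reflexive (invol y))
    ... | no  _ = PM-regressive y

    PM⊣PMᵘ : Adjoint _≤_ _≤_ (PM 𝒦 M) (PMᵘ M)
    PM⊣PMᵘ {x} {y} =
        (λ PMx≤y → ≤-trans (id≤PMᵘ∘PM x) (⋖-monotone⇒monotone PMᵘ-⋖-monotone PMx≤y))
      , (λ x≤PMᵘy → ≤-trans (⋖-monotone⇒monotone PM-⋖-monotone x≤PMᵘy) (PM∘PMᵘ≤id y))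

  evalWordᵘ : List (SPMs 𝒦) → K → K
  evalWordᵘ []             = id
  evalWordᵘ ((M , _) ∷ ws) = evalWordᵘ ws ∘ PMᵘ M

  evalWord⊣evalWordᵘ : ∀ ws → Adjoint _≤_ _≤_ (evalWord 𝒦 ws) (evalWordᵘ ws)
  evalWord⊣evalWordᵘ []              = adjoint-id
  evalWord⊣evalWordᵘ ((_ , sp) ∷ ws) = adjoint-∘ (evalWord⊣evalWordᵘ ws) (PM⊣PMᵘ sp)

  evalWord-regressive : ∀ ws x → evalWord 𝒦 ws x ≤ x
  evalWord-regressive []              x = ≤-refl
  evalWord-regressive ((_ , sp) ∷ ws) x =
    ≤-trans (PM-regressive sp _) (evalWord-regressive ws x)

  InMpK-adjoint : ∀ {f} (f∈MpK : InMpK 𝒦 f) → Adjoint _≤_ _≤_ f (evalWordᵘ (proj₁ f∈MpK))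
  InMpK-adjoint (ws , f≗ws) = adjoint-resp-≗ f≗ws (evalWord⊣evalWordᵘ ws)

  InMpK-regressive : ∀ {f} → InMpK 𝒦 f → ∀ x → f x ≤ x
  InMpK-regressive (ws , f≗ws) x = subst (_≤ x) (sym (f≗ws x)) (evalWord-regressive ws x)

proposition5p7 : (𝒦 : GradedPoset) → let open GradedPoset 𝒦 in
    (P : K → K) → InMpK 𝒦 P → Idempotent 𝒦 P →
    Σ (K → K) λ vP →
      (∀ v → InIm 𝒦 P v →
        InFibre 𝒦 P v (vP v) × (∀ x → InFibre 𝒦 P v x ⇔ InInterval 𝒦 v (vP v) x))
      × (∀ x → ∃ λ v → InIm 𝒦 P v × InInterval 𝒦 v (vP v) x)
      × (∀ x v w → InIm 𝒦 P v → InIm 𝒦 P w →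
          InInterval 𝒦 v (vP v) x → InInterval 𝒦 w (vP w) x → v ≡ w)
proposition5p7 𝒦 P P∈MpK idem = Pᵘ , fibre , covering , disjoint
  where
  open GradedPoset 𝒦
  open IsPartialOrder isPO using (reflexive) renaming (refl to ≤-refl)
  open GaloisConnection isPO
  open Equivalence using (to; from)

  Pᵘ : K → K
  Pᵘ = evalWordᵘ 𝒦 (proj₁ P∈MpK)

  P⊣Pᵘ : Adjoint _≤_ _≤_ P Pᵘ
  P⊣Pᵘ = InMpK-adjoint 𝒦 P∈MpK

  fixed : ∀ {v} → InIm 𝒦 P v → P v ≡ v
  fixed (x , refl) = idem x

  P-fibre⇔interval : ∀ {v} → InIm 𝒦 P v → ∀ x → InFibre 𝒦 P v x ⇔ InInterval 𝒦 v (Pᵘ v) x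
  P-fibre⇔interval im = fibre⇔interval P⊣Pᵘ (InMpK-regressive 𝒦 P∈MpK) (fixed im)

  fibre : ∀ v → InIm 𝒦 P v →
          InFibre 𝒦 P v (Pᵘ v) × (∀ x → InFibre 𝒦 P v x ⇔ InInterval 𝒦 v (Pᵘ v) x)
  fibre v im = from (P-fibre⇔interval im _) (proj₁ P⊣Pᵘ (reflexive (fixed im)) , ≤-refl)
             , P-fibre⇔interval im

  covering : ∀ x → ∃ λ v → InIm 𝒦 P v × InInterval 𝒦 v (Pᵘ v) x
  covering x = P x , (x , refl) , to (P-fibre⇔interval (x , refl) x) refl

  disjoint : ∀ x v w → InIm 𝒦 P v → InIm 𝒦 P w →
             InInterval 𝒦 v (Pᵘ v) x → InInterval 𝒦 w (Pᵘ w) x → v ≡ w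
  disjoint x v w imv imw x∈v x∈w =
    trans (sym (from (P-fibre⇔interval imv x) x∈v)) (from (P-fibre⇔interval imw x) x∈w)
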